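{- Let $U$ be a simple $3$-cuttable unrooted binary phylogenetic network on $X$ and $T$ an unrooted binary phylogenetic $X$-tree displayed by $U$. Let $p$ be an internal vertex of $T$ with neighbors $q$, $u$, $v$, and let $\phi$ be an embedding of $T$ in $U$. If $q$ is not a leaf, then the concatenation of $\phi(\{u,p\})$ and $\phi(\{p,v\})$ is an entangled path between $\phi(u)$ and $\phi(v)$.
   Context: An unrooted binary phylogenetic network on a non-empty finite set $X$ is a simple connected undirected graph whose internal vertices have degree $3$ and whose degree-$1$ vertices (leaves) are bijectively labeled by $X$; a tree such network is an unrooted binary phylogenetic $X$-tree. A cut-edge is an edge whose deletion disconnects the graph. $U$ is simple if every cut-edge is incident to a leaf; $U$ is $3$-cuttable if every cycle contains a path of at least $3$ vertices each incident to a cut-edge. An embedding of $T$ in $U$ is a map $\phi$ sending vertices of $T$ to vertices of $U$ and edges of $T$ to paths of $U$ such that: $\phi(x)=x$ for each leaf $x$; $\phi$ is injective on vertices; $\phi(\{a,b\})$ is a path between $\phi(a)$ and $\phi(b)$ for each edge $\{a,b\}$; paths of distinct edges are edge-disjoint. A path $(v_1,\dots,v_k)$ is entangled if none of its internal vertices $v_2,\dots,v_{k-1}$ is incident to a cut-edge that is not an edge of the path. -}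

module Defs where

open import Data.Nat using (ℕ; _≤_; _<_)
open import Data.Fin using (Fin)
open import Data.Bool using (Bool; true; false; _∧_; not; if_then_else_)
open import Data.List using (List; []; _∷_; _++_; length; filterᵇ; allFin; head; last; take; reverse)
open import Data.List.Relation.Unary.All using (All)
open import Data.List.Relation.Unary.Unique.Propositional using (Unique)
open import Data.Maybe using (Maybe; just)
open import Data.Product using (Σ; _×_; ∃; ∃-syntax; _,_)
open import Data.Sum using (_⊎_)
open import Data.Unit using (⊤)
open import Relation.Binary.PropositionalEquality using (_≡_)
open import Relation.Nullary using (¬_; does)
open import Data.Fin using (_≟_)

Adj : ℕ → Set
Adj n = Fin n → Fin n → Bool

module _ {n : ℕ} where

  Chain : Adj n → List (Fin n) → Set
  Chain A []            = ⊤
  Chain A (x ∷ [])      = ⊤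
  Chain A (x ∷ y ∷ r)   = (A x y ≡ true) × Chain A (y ∷ r)

  IsWalk : Adj n → Fin n → Fin n → List (Fin n) → Set
  IsWalk A a b vs = Chain A vs × head vs ≡ just a × last vs ≡ just b

  IsPath : Adj n → Fin n → Fin n → List (Fin n) → Set
  IsPath A a b vs = IsWalk A a b vs × Unique vs

  Connected : Adj n → Set
  Connected A = ∀ a b → ∃[ vs ] IsWalk A a b vs

  IsCycle : Adj n → List (Fin n) → Set
  IsCycle A cs = Chain A (cs ++ take 1 cs) × Unique cs × 3 ≤ length cs

  degree : Adj n → Fin n → ℕ
  degree A v = length (filterᵇ (A v) (allFin n))

  sameEdgeᵇ : Fin n → Fin n → Fin n → Fin n → Bool
  sameEdgeᵇ a b c d = (does (a ≟ c) ∧ does (b ≟ d)) Data.Bool.∨ (does (a ≟ d) ∧ does (b ≟ c))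

  SameEdge : Fin n → Fin n → Fin n → Fin n → Set
  SameEdge a b c d = (a ≡ c × b ≡ d) ⊎ (a ≡ d × b ≡ c)

  deleteEdge : Adj n → Fin n → Fin n → Adj n
  deleteEdge A a b x y = A x y ∧ not (sameEdgeᵇ a b x y)

  IsCutEdge : Adj n → Fin n → Fin n → Set
  IsCutEdge A a b = (A a b ≡ true) × ¬ Connected (deleteEdge A a b)

  EdgeOf : List (Fin n) → Fin n → Fin n → Set
  EdgeOf vs x y = ∃[ pre ] ∃[ post ]
    ((vs ≡ pre ++ x ∷ y ∷ post) ⊎ (vs ≡ pre ++ y ∷ x ∷ post))

  InternalOf : List (Fin n) → Fin n → Set
  InternalOf vs w = ∃[ pre ] ∃[ post ]
    (vs ≡ pre ++ w ∷ post × ¬ pre ≡ [] × ¬ post ≡ [])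

  Entangled : Adj n → List (Fin n) → Set
  Entangled A vs = ∀ w z → InternalOf vs w → IsCutEdge A w z → EdgeOf vs w z

  IncidentToCutEdge : Adj n → Fin n → Set
  IncidentToCutEdge A v = ∃[ z ] IsCutEdge A v z

-- Unrooted binary phylogenetic network on X = Fin k (k ≥ 1).
-- Leaves are the vertices of degree ≤ 1 (degree 1, except for the
-- one-vertex network when |X| = 1); all other vertices have degree 3.
record Network (k : ℕ) : Set where
  field
    n          : ℕ
    adj        : Adj n
    adj-sym    : ∀ a b → adj a b ≡ adj b a
    adj-irrefl : ∀ a → adj a a ≡ false
    connected  : Connected adj
    X-nonempty : 1 ≤ k
    label      : Fin k → Fin n
    label-inj  : ∀ x y → label x ≡ label y → x ≡ y
    label-leaf : ∀ x → degree adj (label x) ≤ 1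
    leaf-label : ∀ v → degree adj v ≤ 1 → ∃[ x ] label x ≡ v
    internal-3 : ∀ v → ¬ (degree adj v ≤ 1) → degree adj v ≡ 3

module _ {k : ℕ} (N : Network k) where
  open Network N

  IsLeaf : Fin n → Set
  IsLeaf v = degree adj v ≤ 1

  IsTree : Set
  IsTree = ∀ cs → ¬ IsCycle adj cs

  IsSimple : Set
  IsSimple = ∀ a b → IsCutEdge adj a b → IsLeaf a ⊎ IsLeaf b

  -- every cycle contains a path of ≥ 3 vertices (a run of cyclically
  -- consecutive cycle vertices), each incident to a cut-edge
  Is3Cuttable : Set
  Is3Cuttable = ∀ cs → IsCycle adj cs →
    ∃[ ys ] ∃[ zs ] ∃[ ws ] ∃[ rest ]
      (cs ≡ ys ++ zs × zs ++ ys ≡ ws ++ rest × 3 ≤ length ws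
       × All (IncidentToCutEdge adj) ws)

record Embedding {k : ℕ} (T U : Network k) : Set where
  private
    module T = Network T
    module U = Network U
  field
    φV      : Fin T.n → Fin U.n
    φV-inj  : ∀ a b → φV a ≡ φV b → a ≡ b
    φV-leaf : ∀ x → φV (T.label x) ≡ U.label x
    φE      : Fin T.n → Fin T.n → List (Fin U.n)
    φE-path : ∀ a b → T.adj a b ≡ true → IsPath U.adj (φV a) (φV b) (φE a b)
    φE-sym  : ∀ a b → T.adj a b ≡ true → φE b a ≡ reverse (φE a b)
    φE-disj : ∀ a b c d → T.adj a b ≡ true → T.adj c d ≡ true →
              ¬ SameEdge a b c d →
              ∀ x y → EdgeOf (φE a b) x y → ¬ EdgeOf (φE c d) x y

Displays : {k : ℕ} → Network k → Network k → Set
Displays U T = Embedding T U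

{-# OPTIONS --safe #-}
module Submission where

-- Every vertex of U has degree at most 3, and by edge-disjointness the paths of
-- distinct edges of T leave a common vertex of U along distinct edges.  Hence
-- φ(t) is never an interior vertex of the path of an edge not incident to t:
-- t is internal, so two more edges leave φ(t).  This makes φ(u,p) and φ(p,v)
-- meet only in φ(p).  For entanglement, a cut-edge {w,z} at an interior vertex
-- w of the concatenation ends, by simplicity, in a leaf z = φ(ℓ), and the path
-- of the edge of T at ℓ starts with {z,w}.  Unless ℓ ∈ {u,v}, w then has a
-- fourth neighbour: the next vertex on that path or, if that path ends at
-- w = φ(y), the first vertex on the path of a further edge at y (for y = p this
-- is the edge {p,q}, which is why q must not be a leaf).

open import Defs
open import Data.Nat using (ℕ; suc; _≤_; _≤?_; z≤n; s≤s)
open import Data.Nat.Properties using (≤-trans; ≤-reflexive; 1+n≰n)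
open import Data.Bool using (true; T?)
open import Data.Bool.Properties using (T-≡)
open import Data.Fin using (Fin; _≟_)
open import Data.List using (List; []; _∷_; _++_; [_]; _∷ʳ_; length; head; last; reverse; drop;
  filterᵇ; allFin; initLast; _∷ʳ′_)
open import Data.List.Properties using (++-assoc; reverse-++; ∷-injectiveˡ; ∷-injectiveʳ)
open import Data.List.Relation.Unary.All as All using (All; []; _∷_; all?)
open import Data.List.Relation.Unary.All.Properties using (¬All⇒Any¬; ++⁻ˡ; ++⁻ʳ)
open import Data.List.Relation.Unary.AllPairs using ([]; _∷_)
open import Data.List.Relation.Unary.Any using (here; there)
open import Data.List.Relation.Unary.Unique.Propositional using (Unique)
import Data.List.Relation.Unary.Unique.Propositional.Properties as Unique
open import Data.List.Relation.Binary.Disjoint.Propositional using (Disjoint)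
open import Data.List.Relation.Binary.Subset.Propositional using (_⊆_)
open import Data.List.Membership.Propositional using (_∈_; find)
open import Data.List.Membership.Propositional.Properties
  using (∈-∃++; ∈-++⁺ˡ; ∈-++⁺ʳ; ∈-filter⁺; ∈-filter⁻; ∈-allFin)
open import Data.Maybe using (Maybe; just)
open import Data.Maybe.Properties using (just-injective)
open import Data.Product using (_×_; ∃-syntax; _,_; proj₁; proj₂)
open import Data.Sum using (_⊎_; inj₁; inj₂; [_,_]′)
import Data.Sum as Sum
open import Data.Empty using (⊥; ⊥-elim)
open import Function using (_∘_; Equivalence)
open import Relation.Binary.PropositionalEquality
  using (_≡_; _≢_; refl; sym; trans; cong; cong₂; subst; ≢-sym; module ≡-Reasoning)
open import Relation.Nullary using (¬_; yes; no; contradiction)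
open import Relation.Nullary.Decidable using (_⊎-dec_)

module _ {A : Set} where

  private
    remainder : ∀ {x : A} {ys} → x ∈ ys → ∃[ ys′ ] (length ys ≡ suc (length ys′) × ys ⊆ x ∷ ys′)
    remainder (here refl) = _ , refl , λ z∈ys → z∈ys
    remainder {x} {y ∷ ys} (there x∈ys) with remainder x∈ys
    ... | ys′ , len , ys⊆x∷ys′ = y ∷ ys′ , cong suc len , y∷ys⊆
      where
      y∷ys⊆ : y ∷ ys ⊆ x ∷ y ∷ ys′
      y∷ys⊆ (here z≡y) = there (here z≡y)
      y∷ys⊆ (there z∈ys) with ys⊆x∷ys′ z∈ys
      ... | here z≡x    = here z≡x
      ... | there z∈ys′ = there (there z∈ys′)

  Unique⊆⇒length≤ : ∀ {xs ys : List A} → Unique xs → xs ⊆ ys → length xs ≤ length ys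
  Unique⊆⇒length≤ {[]} _ _ = z≤n
  Unique⊆⇒length≤ {x ∷ xs} (x∉xs ∷ u) x∷xs⊆ys with remainder (x∷xs⊆ys (here refl))
  ... | ys′ , len , ys⊆x∷ys′ = subst (suc (length xs) ≤_) (sym len) (s≤s (Unique⊆⇒length≤ u xs⊆ys′))
    where
    xs⊆ys′ : xs ⊆ ys′
    xs⊆ys′ z∈xs with ys⊆x∷ys′ (x∷xs⊆ys (there z∈xs))
    ... | here refl   = contradiction refl (All.lookup x∉xs z∈xs)
    ... | there z∈ys′ = z∈ys′

  Unique-++⁻ : ∀ (xs : List A) {ys} → Unique (xs ++ ys) → Unique xs × Unique ys × Disjoint xs ys
  Unique-++⁻ []       u        = [] , u , λ ()
  Unique-++⁻ (x ∷ xs) (x∉ ∷ u) with Unique-++⁻ xs u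
  ... | u-xs , u-ys , disjoint = ++⁻ˡ xs x∉ ∷ u-xs , u-ys , λ
    { (here refl , v∈ys)   → All.lookup (++⁻ʳ xs x∉) v∈ys refl
    ; (there v∈xs , v∈ys) → disjoint (v∈xs , v∈ys) }

  head-++ : ∀ (xs : List A) y ys → head (xs ++ y ∷ ys) ≡ head (xs ∷ʳ y)
  head-++ []      _ _ = refl
  head-++ (_ ∷ _) _ _ = refl

  last-++ : ∀ (xs : List A) y ys → last (xs ++ y ∷ ys) ≡ last (y ∷ ys)
  last-++ []           _ _  = refl
  last-++ (_ ∷ [])     _ _  = refl
  last-++ (_ ∷ x ∷ xs) y ys = last-++ (x ∷ xs) y ys

  head⇒∷ : ∀ {xs : List A} {x} → head xs ≡ just x → ∃[ ys ] xs ≡ x ∷ ys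
  head⇒∷ {_ ∷ ys} refl = ys , refl

  last⇒∷ʳ : ∀ {xs : List A} {x} → last xs ≡ just x → ∃[ ys ] xs ≡ ys ∷ʳ x
  last⇒∷ʳ {_ ∷ []}     refl = [] , refl
  last⇒∷ʳ {y ∷ z ∷ xs} eq with last⇒∷ʳ {z ∷ xs} eq
  ... | ys , z∷xs≡ = y ∷ ys , cong (y ∷_) z∷xs≡

  window-split : ∀ (pre : List A) {x y post} xs {c ys} → pre ++ x ∷ y ∷ post ≡ xs ++ c ∷ ys →
    (∃[ post′ ] xs ∷ʳ c ≡ pre ++ x ∷ y ∷ post′) ⊎ (∃[ pre′ ] c ∷ ys ≡ pre′ ++ x ∷ y ∷ post)
  window-split []        []           refl = inj₂ ([] , refl)
  window-split []        (_ ∷ [])     refl = inj₁ ([] , refl)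
  window-split []        (_ ∷ _ ∷ xs) refl = inj₁ (xs ∷ʳ _ , refl)
  window-split (a ∷ pre) []           refl = inj₂ (a ∷ pre , refl)
  window-split (a ∷ pre) (_ ∷ xs)     eq with window-split pre xs (∷-injectiveʳ eq) | ∷-injectiveˡ eq
  ... | inj₁ (post′ , eq′) | refl = inj₁ (post′ , cong (a ∷_) eq′)
  ... | inj₂ right         | _    = inj₂ right

  reverse-window : ∀ pre {x y : A} post → reverse (pre ++ x ∷ y ∷ post) ≡ reverse post ++ y ∷ x ∷ reverse pre
  reverse-window pre {x} {y} post = begin
    reverse (pre ++ x ∷ y ∷ post)                 ≡⟨ reverse-++ pre (x ∷ y ∷ post) ⟩
    reverse (x ∷ y ∷ post) ++ reverse pre         ≡⟨ cong (_++ reverse pre) (reverse-++ (x ∷ y ∷ []) post) ⟩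
    (reverse post ++ y ∷ x ∷ []) ++ reverse pre   ≡⟨ ++-assoc (reverse post) (y ∷ x ∷ []) (reverse pre) ⟩
    reverse post ++ y ∷ x ∷ reverse pre           ∎
    where open ≡-Reasoning

module _ {n : ℕ} where

  EdgeOf-++⁺ˡ : ∀ {xs : List (Fin n)} ys {x y} → EdgeOf xs x y → EdgeOf (xs ++ ys) x y
  EdgeOf-++⁺ˡ ys (pre , post , inj₁ refl) = pre , post ++ ys , inj₁ (++-assoc pre _ ys)
  EdgeOf-++⁺ˡ ys (pre , post , inj₂ refl) = pre , post ++ ys , inj₂ (++-assoc pre _ ys)

  EdgeOf-++⁺ʳ : ∀ (xs : List (Fin n)) {ys x y} → EdgeOf ys x y → EdgeOf (xs ++ ys) x y
  EdgeOf-++⁺ʳ xs (pre , post , inj₁ refl) = xs ++ pre , post , inj₁ (sym (++-assoc xs pre _))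
  EdgeOf-++⁺ʳ xs (pre , post , inj₂ refl) = xs ++ pre , post , inj₂ (sym (++-assoc xs pre _))

  EdgeOf-++⁻ : ∀ (xs : List (Fin n)) {c ys x y} → EdgeOf (xs ++ c ∷ ys) x y →
    EdgeOf (xs ∷ʳ c) x y ⊎ EdgeOf (c ∷ ys) x y
  EdgeOf-++⁻ xs (pre , post , inj₁ eq) = Sum.map
    (λ (post′ , eq′) → pre , post′ , inj₁ eq′) (λ (pre′ , eq′) → pre′ , post , inj₁ eq′)
    (window-split pre xs (sym eq))
  EdgeOf-++⁻ xs (pre , post , inj₂ eq) = Sum.map
    (λ (post′ , eq′) → pre , post′ , inj₂ eq′) (λ (pre′ , eq′) → pre′ , post , inj₂ eq′)
    (window-split pre xs (sym eq))

  EdgeOf-reverse : ∀ {xs : List (Fin n)} {x y} → EdgeOf xs x y → EdgeOf (reverse xs) x y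
  EdgeOf-reverse (pre , post , inj₁ refl) = reverse post , reverse pre , inj₂ (reverse-window pre post)
  EdgeOf-reverse (pre , post , inj₂ refl) = reverse post , reverse pre , inj₁ (reverse-window pre post)

  SameEdge-sym : ∀ {a b c d : Fin n} → SameEdge a b c d → SameEdge c d a b
  SameEdge-sym (inj₁ (a≡c , b≡d)) = inj₁ (sym a≡c , sym b≡d)
  SameEdge-sym (inj₂ (a≡d , b≡c)) = inj₂ (sym b≡c , sym a≡d)

  ¬SameEdgeˡ : ∀ {a b c d : Fin n} → a ≢ c → a ≢ d → ¬ SameEdge a b c d
  ¬SameEdgeˡ a≢c _ (inj₁ (a≡c , _)) = a≢c a≡c
  ¬SameEdgeˡ _ a≢d (inj₂ (a≡d , _)) = a≢d a≡d

  ¬SameEdgeʳ : ∀ {a b c d : Fin n} → b ≢ c → b ≢ d → ¬ SameEdge a b c d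
  ¬SameEdgeʳ _ b≢d (inj₁ (_ , b≡d)) = b≢d b≡d
  ¬SameEdgeʳ b≢c _ (inj₂ (_ , b≡c)) = b≢c b≡c

  data Flanked (L : List (Fin n)) (w : Fin n) : Set where
    flanked : ∀ {a b} → EdgeOf L w a → EdgeOf L w b → a ≢ b → Flanked L w

  data Occurrence (L : List (Fin n)) (w : Fin n) : Set where
    initial  : head L ≡ just w → Occurrence L w
    terminal : last L ≡ just w → Occurrence L w
    interior : Flanked L w → Occurrence L w

  private
    flanked-window : ∀ pre {a w b} post → Unique ((pre ∷ʳ a) ++ w ∷ b ∷ post) →
      Flanked ((pre ∷ʳ a) ++ w ∷ b ∷ post) w
    flanked-window pre {a} {w} {b} post u =
      flanked (pre , b ∷ post , inj₂ (++-assoc pre [ a ] (w ∷ b ∷ post))) (pre ∷ʳ a , post , inj₁ refl) a≢b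
      where
      a≢b : a ≢ b
      a≢b refl = proj₂ (proj₂ (Unique-++⁻ (pre ∷ʳ a) u)) (∈-++⁺ʳ pre (here refl) , there (here refl))

  internal⇒flanked : ∀ {L w} → Unique L → InternalOf L w → Flanked L w
  internal⇒flanked u (pre , post , refl , pre≢[] , post≢[]) with initLast pre | post
  ... | []           | _          = contradiction refl pre≢[]
  ... | _ ∷ʳ′ _      | []         = contradiction refl post≢[]
  ... | pre′ ∷ʳ′ _   | _ ∷ post′  = flanked-window pre′ post′ u

  occurrence : ∀ {L w} → Unique L → w ∈ L → Occurrence L w
  occurrence u w∈L with ∈-∃++ w∈L
  ... | pre , post , refl with initLast pre | post
  ...   | []         | _         = initial refl
  ...   | pre′ ∷ʳ′ a | []        = terminal (last-++ (pre′ ∷ʳ a) _ [])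
  ...   | pre′ ∷ʳ′ _ | _ ∷ post′ = interior (flanked-window pre′ post′ u)

  module _ {R : Adj n} where

    Chain-window : ∀ pre {x y post} → Chain R (pre ++ x ∷ y ∷ post) → R x y ≡ true
    Chain-window []            (Rxy , _) = Rxy
    Chain-window (_ ∷ [])      (_ , c)   = Chain-window [] c
    Chain-window (_ ∷ a ∷ pre) (_ , c)   = Chain-window (a ∷ pre) c

    Chain-EdgeOf : (∀ a b → R a b ≡ R b a) → ∀ {L x y} → Chain R L → EdgeOf L x y → R x y ≡ true
    Chain-EdgeOf _   c (pre , _ , inj₁ refl) = Chain-window pre c
    Chain-EdgeOf sym c (pre , _ , inj₂ refl) = trans (sym _ _) (Chain-window pre c)

    Chain-++ : ∀ xs {c ys} → Chain R (xs ∷ʳ c) → Chain R (c ∷ ys) → Chain R (xs ++ c ∷ ys)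
    Chain-++ []           _          c₂ = c₂
    Chain-++ (_ ∷ [])     (Rxc , _)  c₂ = Rxc , c₂
    Chain-++ (_ ∷ y ∷ xs) (Rxy , c₁) c₂ = Rxy , Chain-++ (y ∷ xs) c₁ c₂

    IsWalk-++ : ∀ {a b c} xs {ys} → IsWalk R a c (xs ∷ʳ c) → IsWalk R c b (c ∷ ys) →
      IsWalk R a b (xs ++ c ∷ ys)
    IsWalk-++ {c = c} xs {ys} (c₁ , h₁ , _) (c₂ , _ , l₂) =
      Chain-++ xs c₁ c₂ , trans (head-++ xs c ys) h₁ , trans (last-++ xs c ys) l₂

    walk-first-step : ∀ {a b L} → IsWalk R a b L → a ≢ b → ∃[ d ] ∃[ r ] L ≡ a ∷ d ∷ r
    walk-first-step {L = _ ∷ []}    (_ , refl , refl) a≢b = contradiction refl a≢b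
    walk-first-step {L = _ ∷ d ∷ r} (_ , refl , _)    _   = d , r , refl

module NetworkProperties {k : ℕ} (N : Network k) where
  open Network N

  neighbours : Fin n → List (Fin n)
  neighbours w = filterᵇ (adj w) (allFin n)

  adj⇒∈neighbours : ∀ {w x} → adj w x ≡ true → x ∈ neighbours w
  adj⇒∈neighbours {w} {x} wx = ∈-filter⁺ (T? ∘ adj w) (∈-allFin x) (Equivalence.from T-≡ wx)

  ∈neighbours⇒adj : ∀ {w x} → x ∈ neighbours w → adj w x ≡ true
  ∈neighbours⇒adj {w} x∈ = Equivalence.to T-≡ (proj₂ (∈-filter⁻ (T? ∘ adj w) {xs = allFin n} x∈))

  adj⇒≢ : ∀ {a b} → adj a b ≡ true → a ≢ b
  adj⇒≢ {a} ab refl with trans (sym ab) (adj-irrefl a)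
  ... | ()

  degree≤3 : ∀ w → degree adj w ≤ 3
  degree≤3 w with degree adj w ≤? 1
  ... | yes leaf = ≤-trans leaf (s≤s z≤n)
  ... | no internal = ≤-reflexive (internal-3 w internal)

  distinct-neighbours≤degree : ∀ {w xs} → Unique xs → All (λ x → adj w x ≡ true) xs → length xs ≤ degree adj w
  distinct-neighbours≤degree u adj-all = Unique⊆⇒length≤ u (adj⇒∈neighbours ∘ All.lookup adj-all)

  no-four-neighbours : ∀ {w a b c d} → adj w a ≡ true → adj w b ≡ true → adj w c ≡ true → adj w d ≡ true →
    a ≢ b → a ≢ c → a ≢ d → b ≢ c → b ≢ d → c ≢ d → ⊥
  no-four-neighbours {w} wa wb wc wd a≢b a≢c a≢d b≢c b≢d c≢d = 1+n≰n (≤-trans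
    (distinct-neighbours≤degree ((a≢b ∷ a≢c ∷ a≢d ∷ []) ∷ (b≢c ∷ b≢d ∷ []) ∷ (c≢d ∷ []) ∷ [] ∷ [])
                                (wa ∷ wb ∷ wc ∷ wd ∷ []))
    (degree≤3 w))

  leaf-neighbour-unique : ∀ {w a b} → IsLeaf N w → adj w a ≡ true → adj w b ≡ true → a ≡ b
  leaf-neighbour-unique {a = a} {b} leaf wa wb with a ≟ b
  ... | yes a≡b = a≡b
  ... | no a≢b = ⊥-elim (1+n≰n (≤-trans (distinct-neighbours≤degree ((a≢b ∷ []) ∷ [] ∷ []) (wa ∷ wb ∷ [])) leaf))

  flanked⇒¬leaf : ∀ {L w} → Chain adj L → Flanked L w → ¬ IsLeaf N w
  flanked⇒¬leaf c (flanked wa wb a≢b) leaf =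
    a≢b (leaf-neighbour-unique leaf (Chain-EdgeOf adj-sym c wa) (Chain-EdgeOf adj-sym c wb))

  neighbour-avoiding : ∀ {t} → ¬ IsLeaf N t → ∀ α β → ∃[ s ] (adj t s ≡ true × s ≢ α × s ≢ β)
  neighbour-avoiding {t} internal α β with all? (λ s → s ≟ α ⊎-dec s ≟ β) (neighbours t)
  ... | yes all-αβ = ⊥-elim (1+n≰n (subst (_≤ 2) (internal-3 t internal)
    (Unique⊆⇒length≤ (Unique.filter⁺ (T? ∘ adj t) (Unique.allFin⁺ n)) (αβ-membership ∘ All.lookup all-αβ))))
    where
    αβ-membership : ∀ {s} → s ≡ α ⊎ s ≡ β → s ∈ α ∷ β ∷ []
    αβ-membership = [ here , there ∘ here ]′
  ... | no ¬all with find (¬All⇒Any¬ (λ s → s ≟ α ⊎-dec s ≟ β) (neighbours t) ¬all)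
  ...   | s , s∈ , s∉αβ = s , ∈neighbours⇒adj s∈ , s∉αβ ∘ inj₁ , s∉αβ ∘ inj₂

  neighbour-of-≢ : ∀ {t t′} → t ≢ t′ → ∃[ s ] adj t s ≡ true
  neighbour-of-≢ {t} {t′} t≢t′ with connected t t′
  ... | _ ∷ []    , (_ , refl , refl) = contradiction refl t≢t′
  ... | _ ∷ s ∷ _ , ((ts , _) , refl , _) = s , ts

module EmbeddingProperties {k : ℕ} {T U : Network k} (φ : Embedding T U) where
  private
    module T = Network T
    module U = Network U
    module TP = NetworkProperties T
    module UP = NetworkProperties U
  open Embedding φ

  module _ {t s : Fin T.n} (ts : T.adj t s ≡ true) where

    φE-chain : Chain U.adj (φE t s)
    φE-chain = proj₁ (proj₁ (φE-path t s ts))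

    φE-head : head (φE t s) ≡ just (φV t)
    φE-head = proj₁ (proj₂ (proj₁ (φE-path t s ts)))

    φE-last : last (φE t s) ≡ just (φV s)
    φE-last = proj₂ (proj₂ (proj₁ (φE-path t s ts)))

    φE-unique : Unique (φE t s)
    φE-unique = proj₂ (φE-path t s ts)

    φE-adj : ∀ {x y} → EdgeOf (φE t s) x y → U.adj x y ≡ true
    φE-adj = Chain-EdgeOf U.adj-sym φE-chain

    φE-first-step : ∃[ d ] ∃[ r ] φE t s ≡ φV t ∷ d ∷ r
    φE-first-step = walk-first-step (proj₁ (φE-path t s ts)) (TP.adj⇒≢ ts ∘ φV-inj t s)

    φE-first-edge : ∃[ d ] EdgeOf (φE t s) (φV t) d
    φE-first-edge with d , r , eq ← φE-first-step = d , [] , r , inj₁ eq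

    EdgeOf-φE-sym : ∀ {x y} → EdgeOf (φE t s) x y → EdgeOf (φE s t) x y
    EdgeOf-φE-sym e = subst (λ L → EdgeOf L _ _) (sym (φE-sym t s ts)) (EdgeOf-reverse e)

  φE-distinct-exits : ∀ {a b c d w x y} → T.adj a b ≡ true → T.adj c d ≡ true → ¬ SameEdge a b c d →
    EdgeOf (φE a b) w x → EdgeOf (φE c d) w y → x ≢ y
  φE-distinct-exits ab cd ¬same ex ey refl = φE-disj _ _ _ _ ab cd ¬same _ _ ex ey

  leaf⇒φV-leaf : ∀ {t} → IsLeaf T t → IsLeaf U (φV t)
  leaf⇒φV-leaf {t} leaf with T.leaf-label t leaf
  ... | x , refl = subst (IsLeaf U) (sym (φV-leaf x)) (U.label-leaf x)

  leaf-preimage : ∀ {z} → IsLeaf U z → ∃[ ℓ ] (IsLeaf T ℓ × φV ℓ ≡ z)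
  leaf-preimage {z} leaf with U.leaf-label z leaf
  ... | x , refl = T.label x , T.label-leaf x , φV-leaf x

  leaf-path-start : ∀ {ℓ y w} → IsLeaf T ℓ → T.adj ℓ y ≡ true → U.adj (φV ℓ) w ≡ true →
    ∃[ r ] φE ℓ y ≡ φV ℓ ∷ w ∷ r
  leaf-path-start leaf ℓy zw
    with d , r , eq ← φE-first-step ℓy
    with refl ← UP.leaf-neighbour-unique (leaf⇒φV-leaf leaf) (φE-adj ℓy ([] , r , inj₁ eq)) zw = r , eq

  φV-not-interior : ∀ {c d t} → T.adj c d ≡ true → t ≢ c → t ≢ d → ¬ Flanked (φE c d) (φV t)
  φV-not-interior {c} {d} {t} cd t≢c t≢d fl =
    four-exits (UP.flanked⇒¬leaf (φE-chain cd) fl ∘ leaf⇒φV-leaf) fl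
    where
    off : ∀ {s e b} → T.adj t s ≡ true → EdgeOf (φE t s) (φV t) e → EdgeOf (φE c d) (φV t) b → e ≢ b
    off ts = φE-distinct-exits ts cd (¬SameEdgeˡ t≢c t≢d)

    four-exits : ¬ IsLeaf T t → ¬ Flanked (φE c d) (φV t)
    four-exits t-internal (flanked eb₀ eb₁ b₀≢b₁)
      with s₁ , ts₁ , _ , _ ← TP.neighbour-avoiding t-internal t t
      with s₂ , ts₂ , s₂≢s₁ , _ ← TP.neighbour-avoiding t-internal s₁ s₁
      with d₁ , ed₁ ← φE-first-edge ts₁
      with d₂ , ed₂ ← φE-first-edge ts₂ =
      UP.no-four-neighbours (φE-adj ts₁ ed₁) (φE-adj ts₂ ed₂) (φE-adj cd eb₀) (φE-adj cd eb₁)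
        (φE-distinct-exits ts₁ ts₂ (¬SameEdgeʳ (≢-sym (TP.adj⇒≢ ts₁)) (≢-sym s₂≢s₁)) ed₁ ed₂)
        (off ts₁ ed₁ eb₀) (off ts₁ ed₁ eb₁) (off ts₂ ed₂ eb₀) (off ts₂ ed₂ eb₁) b₀≢b₁

module Concatenation {k : ℕ} {U T : Network k} (φ : Embedding T U)
  {p u v : Fin (Network.n T)} (up : Network.adj T u p ≡ true) (pv : Network.adj T p v ≡ true) (u≢v : u ≢ v)
  {xs ys : List (Fin (Network.n U))}
  (φE-up≡ : Embedding.φE φ u p ≡ xs ∷ʳ Embedding.φV φ p)
  (φE-pv≡ : Embedding.φE φ p v ≡ Embedding.φV φ p ∷ ys) where
  private
    module T = Network T
    module U = Network U
    module TP = NetworkProperties T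
    module UP = NetworkProperties U
  open Embedding φ
  open EmbeddingProperties φ

  P : List (Fin U.n)
  P = xs ++ φV p ∷ ys

  P≡φE-concatenation : P ≡ φE u p ++ drop 1 (φE p v)
  P≡φE-concatenation = begin
    xs ++ φV p ∷ ys                     ≡⟨ ++-assoc xs [ φV p ] ys ⟨
    (xs ∷ʳ φV p) ++ drop 1 (φV p ∷ ys)  ≡⟨ cong₂ (λ A B → A ++ drop 1 B) φE-up≡ φE-pv≡ ⟨
    φE u p ++ drop 1 (φE p v)           ∎
    where open ≡-Reasoning

  private
    transport : ∀ {L L′ : List (Fin U.n)} {w x} → L ≡ L′ → EdgeOf L w x → EdgeOf L′ w x
    transport = subst (λ L → EdgeOf L _ _)

  P-edge⁻ : ∀ {w x} → EdgeOf P w x → EdgeOf (φE u p) w x ⊎ EdgeOf (φE p v) w x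
  P-edge⁻ = Sum.map (transport (sym φE-up≡)) (transport (sym φE-pv≡)) ∘ EdgeOf-++⁻ xs

  P-edge⁺ˡ : ∀ {w x} → EdgeOf (φE u p) w x → EdgeOf P w x
  P-edge⁺ˡ = transport (++-assoc xs [ φV p ] ys) ∘ EdgeOf-++⁺ˡ ys ∘ transport φE-up≡

  P-edge⁺ʳ : ∀ {w x} → EdgeOf (φE p v) w x → EdgeOf P w x
  P-edge⁺ʳ = EdgeOf-++⁺ʳ xs ∘ transport φE-pv≡

  P-walk : IsWalk U.adj (φV u) (φV v) P
  P-walk = IsWalk-++ xs (subst (IsWalk U.adj _ _) φE-up≡ (proj₁ (φE-path u p up)))
                        (subst (IsWalk U.adj _ _) φE-pv≡ (proj₁ (φE-path p v pv)))

  P-adj : ∀ {w x} → EdgeOf P w x → U.adj w x ≡ true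
  P-adj = Chain-EdgeOf U.adj-sym (proj₁ P-walk)

  P-off : ∀ {t s w d x} → T.adj t s ≡ true → ¬ SameEdge t s u p → ¬ SameEdge t s p v →
    EdgeOf (φE t s) w d → EdgeOf P w x → d ≢ x
  P-off ts ¬up ¬pv ed ex with P-edge⁻ ex
  ... | inj₁ ex′ = φE-distinct-exits ts up ¬up ed ex′
  ... | inj₂ ex′ = φE-distinct-exits ts pv ¬pv ed ex′

  private
    xs-disjoint-from-φp : Disjoint xs [ φV p ]
    xs-disjoint-from-φp = proj₂ (proj₂ (Unique-++⁻ xs (subst Unique φE-up≡ (φE-unique up))))

    same-end : ∀ {m : Maybe (Fin U.n)} {a b} → m ≡ just a → m ≡ just b → a ≡ b
    same-end ma mb = just-injective (trans (sym ma) mb)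

  xs-disjoint : Disjoint xs (φV p ∷ ys)
  xs-disjoint {w} (w∈xs , w∈φE-pv) =
    meet (occurrence (φE-unique up) (subst (w ∈_) (sym φE-up≡) (∈-++⁺ˡ w∈xs)))
         (occurrence (φE-unique pv) (subst (w ∈_) (sym φE-pv≡) w∈φE-pv))
    where
    w≢φp : w ≢ φV p
    w≢φp refl = xs-disjoint-from-φp (w∈xs , here refl)

    meet : Occurrence (φE u p) w → Occurrence (φE p v) w → ⊥
    meet (terminal l) _            = w≢φp (same-end l (φE-last up))
    meet _            (initial h)  = w≢φp (same-end h (φE-head pv))
    meet (initial h)  (terminal l) = u≢v (φV-inj u v (trans (same-end (φE-head up) h) (same-end l (φE-last pv))))
    meet (initial h)  (interior fl) =
      φV-not-interior pv (TP.adj⇒≢ up) u≢v (subst (Flanked _) (same-end h (φE-head up)) fl)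
    meet (interior fl) (terminal l) =
      φV-not-interior up (≢-sym u≢v) (≢-sym (TP.adj⇒≢ pv)) (subst (Flanked _) (same-end l (φE-last pv)) fl)
    meet (interior (flanked ea₀ ea₁ a₀≢a₁)) (interior (flanked eb₀ eb₁ b₀≢b₁)) =
      UP.no-four-neighbours (φE-adj up ea₀) (φE-adj up ea₁) (φE-adj pv eb₀) (φE-adj pv eb₁)
        a₀≢a₁ (exit ea₀ eb₀) (exit ea₀ eb₁) (exit ea₁ eb₀) (exit ea₁ eb₁) b₀≢b₁
      where
      exit : ∀ {x y} → EdgeOf (φE u p) w x → EdgeOf (φE p v) w y → x ≢ y
      exit = φE-distinct-exits up pv (¬SameEdgeˡ (TP.adj⇒≢ up) u≢v)

  P-unique : Unique P
  P-unique = Unique.++⁺ (proj₁ (Unique-++⁻ xs (subst Unique φE-up≡ (φE-unique up))))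
                        (subst Unique φE-pv≡ (φE-unique pv)) xs-disjoint

  P-path : IsPath U.adj (φV u) (φV v) P
  P-path = P-walk , P-unique

  module _ (simple : IsSimple U) {q : Fin T.n} (pq : T.adj p q ≡ true) (q≢u : q ≢ u) (q≢v : q ≢ v)
           (p-internal : ¬ IsLeaf T p) (q-internal : ¬ IsLeaf T q) where

    leaf≢p : ∀ {ℓ} → IsLeaf T ℓ → ℓ ≢ p
    leaf≢p ℓ-leaf refl = p-internal ℓ-leaf

    edge-off-P : ∀ {y ℓ} → ¬ IsLeaf T y → IsLeaf T ℓ →
      ∃[ s ] (T.adj y s ≡ true × s ≢ ℓ × ¬ SameEdge y s u p × ¬ SameEdge y s p v)
    edge-off-P {y} {ℓ} y-internal ℓ-leaf with y ≟ p
    ... | yes refl = q , pq , (λ { refl → q-internal ℓ-leaf }) , ¬SameEdgeʳ q≢u q≢p , ¬SameEdgeʳ q≢p q≢v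
      where
      q≢p : q ≢ p
      q≢p = ≢-sym (TP.adj⇒≢ pq)
    ... | no y≢p with s , ys , s≢ℓ , s≢p ← TP.neighbour-avoiding y-internal ℓ p =
      s , ys , s≢ℓ , ¬SameEdgeʳ (≢-sym y≢p) (≢-sym s≢p) ∘ SameEdge-sym
                   , ¬SameEdgeˡ (≢-sym y≢p) (≢-sym s≢p) ∘ SameEdge-sym

    fourth-neighbour : ∀ {ℓ y w r} → IsLeaf T ℓ → ℓ ≢ u → ℓ ≢ v → T.adj ℓ y ≡ true →
      φE ℓ y ≡ φV ℓ ∷ w ∷ r → Flanked P w →
      ∃[ e ] (U.adj w e ≡ true × e ≢ φV ℓ × ∀ {x} → EdgeOf P w x → e ≢ x)
    fourth-neighbour {ℓ} {y} {w} {c ∷ r} ℓ-leaf ℓ≢u ℓ≢v ℓy eq _ =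
      c , φE-adj ℓy ec , ≢-sym z≢c , P-off ℓy (¬SameEdgeˡ ℓ≢u ℓ≢p) (¬SameEdgeˡ ℓ≢p ℓ≢v) ec
      where
      ℓ≢p : ℓ ≢ p
      ℓ≢p = leaf≢p ℓ-leaf
      ec : EdgeOf (φE ℓ y) w c
      ec = φV ℓ ∷ [] , r , inj₁ eq
      z≢c : φV ℓ ≢ c
      z≢c with (_ ∷ φℓ≢c ∷ _) ∷ _ ← subst Unique eq (φE-unique ℓy) = φℓ≢c
    fourth-neighbour {ℓ} {y} {r = []} ℓ-leaf _ _ ℓy eq fl
      with refl ← just-injective (trans (sym (φE-last ℓy)) (cong last eq))
      with s , ys , s≢ℓ , ¬up , ¬pv ← edge-off-P (UP.flanked⇒¬leaf (proj₁ P-walk) fl ∘ leaf⇒φV-leaf) ℓ-leaf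
      with e , ee ← φE-first-edge ys =
      e , φE-adj ys ee , φE-distinct-exits ys ℓy (¬SameEdgeʳ s≢ℓ (≢-sym (TP.adj⇒≢ ys))) ee ([] , [] , inj₂ eq)
        , P-off ys ¬up ¬pv ee

    leaf-edge-on-P : ∀ {w a b ℓ} → EdgeOf P w a → EdgeOf P w b → a ≢ b → IsLeaf T ℓ →
      U.adj w (φV ℓ) ≡ true → φV ℓ ≢ a → φV ℓ ≢ b → EdgeOf P w (φV ℓ)
    leaf-edge-on-P {w} {ℓ = ℓ} ea eb a≢b ℓ-leaf wz z≢a z≢b
      with y , ℓy ← TP.neighbour-of-≢ (leaf≢p ℓ-leaf)
      with r , eq ← leaf-path-start ℓ-leaf ℓy (trans (U.adj-sym _ _) wz)
      with ℓ ≟ u | ℓ ≟ v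
    ... | yes refl | _ with refl ← TP.leaf-neighbour-unique ℓ-leaf ℓy up =
      P-edge⁺ˡ ([] , r , inj₂ eq)
    ... | _ | yes refl with refl ← TP.leaf-neighbour-unique ℓ-leaf ℓy (trans (T.adj-sym v p) pv) =
      P-edge⁺ʳ (EdgeOf-φE-sym ℓy ([] , r , inj₂ eq))
    ... | no ℓ≢u | no ℓ≢v with e , we , e≢z , e-off ← fourth-neighbour ℓ-leaf ℓ≢u ℓ≢v ℓy eq (flanked ea eb a≢b) =
      ⊥-elim (UP.no-four-neighbours (P-adj ea) (P-adj eb) wz we a≢b (≢-sym z≢a) (≢-sym (e-off ea))
                                    (≢-sym z≢b) (≢-sym (e-off eb)) (≢-sym e≢z))

    P-entangled : Entangled U.adj P
    P-entangled w z w-internal cut with internal⇒flanked P-unique w-internal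
    ... | flanked {a} {b} ea eb a≢b with z ≟ a | z ≟ b
    ...   | yes refl | _        = ea
    ...   | no _     | yes refl = eb
    ...   | no z≢a   | no z≢b with simple w z cut
    ...     | inj₁ w-leaf = ⊥-elim (UP.flanked⇒¬leaf (proj₁ P-walk) (flanked ea eb a≢b) w-leaf)
    ...     | inj₂ z-leaf with ℓ , ℓ-leaf , refl ← leaf-preimage z-leaf =
      leaf-edge-on-P ea eb a≢b ℓ-leaf (proj₁ cut) z≢a z≢b

lemma9 : {k : ℕ} (U T : Network k) →
    IsSimple U → Is3Cuttable U → IsTree T → Displays U T →
    (p q u v : Fin (Network.n T)) →
    ¬ IsLeaf T p →
    Network.adj T p q ≡ true → Network.adj T p u ≡ true → Network.adj T p v ≡ true →
    ¬ q ≡ u → ¬ q ≡ v → ¬ u ≡ v →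
    (φ : Embedding T U) →
    ¬ IsLeaf T q →
    IsPath (Network.adj U) (Embedding.φV φ u) (Embedding.φV φ v)
        (Embedding.φE φ u p ++ drop 1 (Embedding.φE φ p v))
      × Entangled (Network.adj U) (Embedding.φE φ u p ++ drop 1 (Embedding.φE φ p v))
lemma9 U T simple _ _ _ p q u v p-internal pq pu pv q≢u q≢v u≢v φ q-internal =
  subst (λ L → IsPath (Network.adj U) _ _ L × Entangled (Network.adj U) L) P≡φE-concatenation
    (P-path , P-entangled simple pq q≢u q≢v p-internal q-internal)
  where
  open EmbeddingProperties φ
  up : Network.adj T u p ≡ true
  up = trans (Network.adj-sym T u p) pu
  open Concatenation φ up pv u≢v (proj₂ (last⇒∷ʳ (φE-last up))) (proj₂ (head⇒∷ (φE-head pv)))
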